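{- Let $G$ be a graph and let $G_u$ be obtained from $G$ by adding a universal vertex $u$. If $G$ is a triangle free graph with at least 3 vertices, then $\mathrm{ti}_{g}(G_u)=\max\{\mathrm{ti}_{P_3}(G),1\}$ and $\mathrm{gp}_{g}(G_u)=\max\{\mathrm{gp}_{P_3}(G),\ \omega(G)+1\}$.
   Context: For a graph convexity with interval function $I$ (the geodesic convexity, where $I_g(S)$ is the set of vertices on shortest paths with endpoints in $S$, or the $P_3$ convexity, where $I_{P_3}(S)$ is $S$ plus the vertices on paths of order three with endpoints in $S$), the iteration time of a set $S$ is the minimum $k$ such that $I^k(S)$ equals the convex hull of $S$, and the iteration time $\mathrm{ti}(G)$ of the graph is the maximum over all $S\subseteq V(G)$; the subscripts $g$ and $P_3$ indicate the convexity. A set $S$ is in general position if $z\notin I(\{x,y\})$ for all distinct $x,y,z\in S$, and $\mathrm{gp}(G)$ is the maximum size of such a set. $\omega(G)$ is the clique number of $G$. -}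

module Defs where

open import Data.Nat using (ℕ; zero; suc; _≤_; _<_)
open import Data.Fin using (Fin; zero; suc)
open import Data.Fin.Subset using (Subset; _∈_; ∣_∣)
open import Data.Bool using (Bool; true; false)
open import Data.Product using (Σ; ∃; _×_; _,_)
open import Data.Sum using (_⊎_)
open import Data.Empty using (⊥)
open import Relation.Nullary using (¬_)
open import Relation.Binary.PropositionalEquality using (_≡_; _≢_)
open import Level using (Level) renaming (suc to lsuc)

record Graph (n : ℕ) : Set where
  field
    adj   : Fin n → Fin n → Bool
    sym   : ∀ x y → adj x y ≡ adj y x
    irrefl : ∀ x → adj x x ≡ false
open Graph public

Adj : ∀ {n} → Graph n → Fin n → Fin n → Set
Adj G x y = adj G x y ≡ true

-- G_u : add a universal vertex u, here u = zero, old vertex v becomes suc v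
universalAdj : ∀ {n} → Graph n → Fin (suc n) → Fin (suc n) → Bool
universalAdj G zero    zero    = false
universalAdj G zero    (suc _) = true
universalAdj G (suc _) zero    = true
universalAdj G (suc x) (suc y) = adj G x y

universalSym : ∀ {n} (G : Graph n) x y → universalAdj G x y ≡ universalAdj G y x
universalSym G zero    zero    = _≡_.refl
universalSym G zero    (suc _) = _≡_.refl
universalSym G (suc _) zero    = _≡_.refl
universalSym G (suc x) (suc y) = sym G x y

universalIrrefl : ∀ {n} (G : Graph n) x → universalAdj G x x ≡ false
universalIrrefl G zero    = _≡_.refl
universalIrrefl G (suc x) = irrefl G x

addUniversal : ∀ {n} → Graph n → Graph (suc n)
addUniversal G = record
  { adj = universalAdj G ; sym = universalSym G ; irrefl = universalIrrefl G }

u : ∀ {n} → Fin (suc n)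
u = zero

TriangleFree : ∀ {n} → Graph n → Set
TriangleFree G = ∀ x y z → Adj G x y → Adj G y z → Adj G x z → ⊥

VPred : ℕ → Set₁
VPred n = Fin n → Set

IntervalFn : ℕ → Set₁
IntervalFn n = VPred n → VPred n

⟦_⟧ : ∀ {n} → Subset n → VPred n
⟦ S ⟧ v = v ∈ S

pair : ∀ {n} → Fin n → Fin n → VPred n
pair x y v = (v ≡ x) ⊎ (v ≡ y)

data Walk {n} (G : Graph n) : Fin n → Fin n → ℕ → Set where
  nil  : ∀ x → Walk G x x 0
  cons : ∀ {x y z k} → Adj G x y → Walk G y z k → Walk G x z (suc k)

data OnWalk {n} {G : Graph n} (z : Fin n) : ∀ {x y k} → Walk G x y k → Set where
  here-nil  : OnWalk z (nil z)
  here-cons : ∀ {y w k} (e : Adj G z y) (p : Walk G y w k) → OnWalk z (cons e p)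
  there     : ∀ {x y w k} (e : Adj G x y) (p : Walk G y w k) → OnWalk z p → OnWalk z (cons e p)

OnGeodesic : ∀ {n} → Graph n → Fin n → Fin n → Fin n → Set
OnGeodesic G x y z =
  Σ ℕ λ k → Σ (Walk G x y k) λ p → OnWalk z p × (∀ k' → Walk G x y k' → k ≤ k')

Ig : ∀ {n} → Graph n → IntervalFn n
Ig G S z = Σ _ λ x → Σ _ λ y → S x × S y × OnGeodesic G x y z

IP3 : ∀ {n} → Graph n → IntervalFn n
IP3 G S z = S z ⊎ (Σ _ λ x → Σ _ λ y → S x × S y × x ≢ y × Adj G x z × Adj G z y)

iter : ∀ {n} → IntervalFn n → ℕ → VPred n → VPred n
iter I zero    S = S
iter I (suc k) S = I (iter I k S)

Convex : ∀ {n} → IntervalFn n → VPred n → Set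
Convex I C = ∀ z → I C z → C z

Hull : ∀ {n} → IntervalFn n → VPred n → Fin n → Set₁
Hull I S z = ∀ (C : VPred _) → Convex I C → (∀ v → S v → C v) → C z

IterReachesHull : ∀ {n} → IntervalFn n → VPred n → ℕ → Set₁
IterReachesHull I S k = ∀ z → (Hull I S z → iter I k S z) × (iter I k S z → Hull I S z)

IsIterTimeOf : ∀ {n} → IntervalFn n → Subset n → ℕ → Set₁
IsIterTimeOf I S k =
  IterReachesHull I ⟦ S ⟧ k × (∀ j → j < k → ¬ IterReachesHull I ⟦ S ⟧ j)

IsIterTime : ∀ {n} → IntervalFn n → ℕ → Set₁
IsIterTime {n} I k =
  (Σ (Subset n) λ S → IsIterTimeOf I S k) × (∀ S j → IsIterTimeOf I S j → j ≤ k)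

GeneralPosition : ∀ {n} → IntervalFn n → Subset n → Set
GeneralPosition I S =
  ∀ x y z → x ∈ S → y ∈ S → z ∈ S → x ≢ y → x ≢ z → y ≢ z → ¬ I (pair x y) z

IsGpNumber : ∀ {n} → IntervalFn n → ℕ → Set
IsGpNumber {n} I k =
  (Σ (Subset n) λ S → GeneralPosition I S × ∣ S ∣ ≡ k)
  × (∀ S → GeneralPosition I S → ∣ S ∣ ≤ k)

Clique : ∀ {n} → Graph n → Subset n → Set
Clique G S = ∀ x y → x ∈ S → y ∈ S → x ≢ y → Adj G x y

IsCliqueNumber : ∀ {n} → Graph n → ℕ → Set
IsCliqueNumber {n} G k =
  (Σ (Subset n) λ S → Clique G S × ∣ S ∣ ≡ k)
  × (∀ S → Clique G S → ∣ S ∣ ≤ k)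

{-# OPTIONS --safe #-}
module Submission where

open import Defs hiding (sym)
open import Data.Nat using (ℕ; zero; suc; _≤_; _<_; _⊔_; z≤n; s≤s; _≤?_)
open import Data.Nat.Properties
  using (≤-trans; ≰⇒>; <⇒≤; m≤m⊔n; m≤n⊔m; m≥n⇒m⊔n≡m; m≤n⇒m⊔n≡n; ⊔-identityʳ)
open import Data.Nat.Induction using (<-rec)
open import Data.Product using (_×_; _,_; proj₁; proj₂; ∃; ∃₂)
open import Data.Sum using (_⊎_; inj₁; inj₂)
import Data.Sum as Sum
open import Data.Empty using (⊥-elim)
open import Data.Unit using (⊤; tt)
open import Data.Bool using (true; false)
import Data.Bool.Properties as Bool
open import Data.Fin using (Fin; zero; suc; _≟_)
open import Data.Fin.Properties using (suc-injective; any?)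
open import Data.Fin.Subset using (Subset; _∈_; ∣_∣) renaming (⊤ to full)
open import Data.Fin.Subset.Properties using (drop-there; _∈?_; ∈⊤)
open import Data.Vec using (_∷_; here; there)
open import Function using (_∘_; id)
open import Relation.Nullary using (¬_; Dec; yes; no)
open import Relation.Nullary.Decidable using (_×-dec_; ¬?; ¬¬-excluded-middle)
open import Relation.Unary using (_⊆_; _≐_)
open import Relation.Binary.PropositionalEquality using (_≡_; refl; cong; subst; sym; trans; _≢_)

-- In G_u every two vertices are at distance at most 2, so a vertex lies on a
-- geodesic between x and y only if it is an endpoint or a common neighbour of a
-- non-adjacent pair. Old vertices arising this way are exactly the P₃-interval
-- vertices of G (in a triangle-free graph a common neighbour of x and y forces
-- x and y to be non-adjacent), and u arises as soon as the old part of S contains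
-- a non-edge, i.e. in the first step or never. Hence on old vertices the geodesic
-- iteration in G_u runs in lockstep with the P₃ iteration in G, and the only extra
-- step is the one adding u when the P₃ iteration time is 0. A set in
-- general position in G_u either avoids u, where it is a P₃ general position set
-- of G, or contains u, in which case its other vertices form a clique.

Monotone : ∀ {n} → IntervalFn n → Set₁
Monotone I = ∀ {P Q} → P ⊆ Q → I P ⊆ I Q

Extensive : ∀ {n} → IntervalFn n → Set₁
Extensive I = ∀ {P} → P ⊆ I P

module IntervalFunction {n} {I : IntervalFn n} (mono : Monotone I) (ext : Extensive I) where

  iter-increasing : ∀ {P i k} → i ≤ k → iter I i P ⊆ iter I k P
  iter-increasing {k = zero}  z≤n       = id
  iter-increasing {i = zero} {suc k} z≤n = ext ∘ iter-increasing {k = k} z≤n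
  iter-increasing             (s≤s i≤k) = mono (iter-increasing i≤k)

  iter⊆hull : ∀ k {P} → iter I k P ⊆ Hull I P
  iter⊆hull zero    x C _      P⊆C = P⊆C _ x
  iter⊆hull (suc k) x C convex P⊆C = convex _ (mono (λ y → iter⊆hull k y C convex P⊆C) x)

  reachesHull-mono : ∀ {P i k} → IterReachesHull I P i → i ≤ k → IterReachesHull I P k
  reachesHull-mono {k = k} reach i≤k z = iter-increasing i≤k ∘ proj₁ (reach z) , iter⊆hull k

  convex⇒reachesHull0 : ∀ {P} → Convex I P → IterReachesHull I P 0
  convex⇒reachesHull0 convex z = (λ h → h _ convex (λ _ p → p)) , iter⊆hull 0

Least : ∀ {ℓ} → (ℕ → Set ℓ) → Set ℓ
Least P = ∃ λ i → P i × (∀ j → j < i → ¬ P j)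

-- For an undecidable P (such as reaching the hull) the least witness exists only
-- under a double negation.
¬¬-least : ∀ {ℓ} (P : ℕ → Set ℓ) {k} → P k → ¬ ¬ Least P
¬¬-least P = <-rec (λ k → P k → ¬ ¬ Least P) step _
  where
  step : ∀ k → (∀ {j} → j < k → P j → ¬ ¬ Least P) → P k → ¬ ¬ Least P
  step k below pk noLeast = ¬¬-excluded-middle {A = ∃ λ j → j < k × P j} λ
    { (yes (j , j<k , pj)) → below j<k pj noLeast
    ; (no none)            → noLeast (k , pk , λ j j<k pj → none (j , j<k , pj)) }

s<n⊔1⇒s<n : ∀ {j t} → suc j < t ⊔ 1 → suc j < t
s<n⊔1⇒s<n {t = zero}  (s≤s ())
s<n⊔1⇒s<n {j} {suc t} lt = subst (suc j <_) (cong suc (⊔-identityʳ t)) lt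

pair-map : ∀ {m k} (f : Fin m → Fin k) {x y w} → pair x y w → pair (f x) (f y) (f w)
pair-map f = Sum.map (cong f) (cong f)

pair-suc⁻¹ : ∀ {m} {x y w : Fin m} → pair (suc x) (suc y) (suc w) → pair x y w
pair-suc⁻¹ = Sum.map suc-injective suc-injective

restrict-cons : ∀ {n} b (S : Subset n) → ⟦ S ⟧ ≐ ⟦ b ∷ S ⟧ ∘ suc
restrict-cons b S = there , drop-there

module _ {n} (H : Graph n) where

  NonEdge : Fin n → Fin n → Set
  NonEdge x y = x ≢ y × ¬ Adj H x y

  HasNonEdge : VPred n → Set
  HasNonEdge S = ∃₂ λ x y → S x × S y × NonEdge x y

  HasNonEdge-mono : ∀ {S T} → S ⊆ T → HasNonEdge S → HasNonEdge T
  HasNonEdge-mono S⊆T (x , y , Sx , Sy , xy) = x , y , S⊆T Sx , S⊆T Sy , xy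

  hasNonEdge? : (S : Subset n) → Dec (HasNonEdge ⟦ S ⟧)
  hasNonEdge? S = any? λ x → any? λ y →
    (x ∈? S) ×-dec (y ∈? S) ×-dec ¬? (x ≟ y) ×-dec ¬? (adj H x y Bool.≟ true)

  DiameterAtMost2 : Set
  DiameterAtMost2 = ∀ x y → ∃ λ k → k ≤ 2 × Walk H x y k

  onWalk-short : ∀ {x y z k} (w : Walk H x y k) → k ≤ 2 → OnWalk z w →
                 z ≡ x ⊎ z ≡ y ⊎ (k ≡ 2 × Adj H x z × Adj H z y)
  onWalk-short (nil _)                     _ here-nil                          = inj₁ refl
  onWalk-short (cons _ _)                  _ (here-cons _ _)                   = inj₁ refl
  onWalk-short (cons _ (nil _))            _ (there _ _ here-nil)              = inj₂ (inj₁ refl)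
  onWalk-short (cons e (cons e′ (nil _)))  _ (there _ _ (here-cons _ _))       =
    inj₂ (inj₂ (refl , e , e′))
  onWalk-short (cons _ (cons _ (nil _)))   _ (there _ _ (there _ _ here-nil))  = inj₂ (inj₁ refl)
  onWalk-short (cons _ (cons _ (cons _ _))) (s≤s (s≤s ())) _

  walk0⇒≡ : ∀ {x y} → Walk H x y 0 → x ≡ y
  walk0⇒≡ (nil _) = refl

  walk1⇒Adj : ∀ {x y} → Walk H x y 1 → Adj H x y
  walk1⇒Adj (cons e (nil _)) = e

  onGeodesic-diameter2 : DiameterAtMost2 → ∀ {x y z} → OnGeodesic H x y z →
                         z ≡ x ⊎ z ≡ y ⊎ (NonEdge x y × Adj H x z × Adj H z y)
  onGeodesic-diameter2 diam {x} {y} (k , w , z∈w , shortest) with diam x y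
  ... | k′ , k′≤2 , w′ with onWalk-short w (≤-trans (shortest k′ w′) k′≤2) z∈w
  ...   | inj₁ z≡x                      = inj₁ z≡x
  ...   | inj₂ (inj₁ z≡y)               = inj₂ (inj₁ z≡y)
  ...   | inj₂ (inj₂ (refl , x~z , z~y)) = inj₂ (inj₂ ((x≢y , ¬x~y) , x~z , z~y))
    where
    x≢y : x ≢ y
    x≢y refl with shortest 0 (nil x)
    ... | ()
    ¬x~y : ¬ Adj H x y
    ¬x~y x~y with shortest 1 (cons x~y (nil y))
    ... | s≤s ()

  onGeodesic-middle : ∀ {x y z} → NonEdge x y → Adj H x z → Adj H z y → OnGeodesic H x y z
  onGeodesic-middle (x≢y , ¬x~y) x~z z~y =
    2 , cons x~z (cons z~y (nil _)) , there x~z _ (here-cons z~y (nil _)) , shortest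
    where
    shortest : ∀ k → Walk H _ _ k → 2 ≤ k
    shortest zero          w = ⊥-elim (x≢y (walk0⇒≡ w))
    shortest (suc zero)    w = ⊥-elim (¬x~y (walk1⇒Adj w))
    shortest (suc (suc _)) _ = s≤s (s≤s z≤n)

  Ig-monotone : Monotone (Ig H)
  Ig-monotone P⊆Q (x , y , Px , Py , geo) = x , y , P⊆Q Px , P⊆Q Py , geo

  Ig-extensive : Extensive (Ig H)
  Ig-extensive {x = x} Px = x , x , Px , Px , 0 , nil x , here-nil , λ _ _ → z≤n

  IP3-monotone : Monotone (IP3 H)
  IP3-monotone P⊆Q = Sum.map P⊆Q λ (x , y , Px , Py , rest) → x , y , P⊆Q Px , P⊆Q Py , rest

  IP3-extensive : Extensive (IP3 H)
  IP3-extensive = inj₁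

  Ig-closed-pairwiseAdjacent : DiameterAtMost2 → ∀ {S} →
    (∀ {x y} → S x → S y → x ≢ y → Adj H x y) → Ig H S ⊆ S
  Ig-closed-pairwiseAdjacent diam adjacent (x , y , Sx , Sy , geo)
    with onGeodesic-diameter2 diam geo
  ... | inj₁ refl                           = Sx
  ... | inj₂ (inj₁ refl)                    = Sy
  ... | inj₂ (inj₂ ((x≢y , ¬x~y) , _ , _)) = ⊥-elim (¬x~y (adjacent Sx Sy x≢y))

triangleFree⇒nonEdge : ∀ {n} (G : Graph n) → TriangleFree G → 3 ≤ n → ∃₂ (NonEdge G)
triangleFree⇒nonEdge G tf (s≤s (s≤s (s≤s z≤n)))
  with adj G zero (suc zero) Bool.≟ true | adj G zero (suc (suc zero)) Bool.≟ true
     | adj G (suc zero) (suc (suc zero)) Bool.≟ true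
... | no ¬0~1 | _       | _       = zero , suc zero , (λ ()) , ¬0~1
... | yes _   | no ¬0~2 | _       = zero , suc (suc zero) , (λ ()) , ¬0~2
... | yes _   | yes _   | no ¬1~2 = suc zero , suc (suc zero) , (λ ()) , ¬1~2
... | yes 0~1 | yes 0~2 | yes 1~2 = ⊥-elim (tf zero (suc zero) (suc (suc zero)) 0~1 1~2 0~2)

noNonEdge⇒IP3-convex : ∀ {n} (G : Graph n) → TriangleFree G → ∀ {Q} →
                       ¬ HasNonEdge G Q → Convex (IP3 G) Q
noNonEdge⇒IP3-convex G tf noNonEdge z (inj₁ Qz) = Qz
noNonEdge⇒IP3-convex G tf noNonEdge z (inj₂ (x , y , Qx , Qy , x≢y , x~z , z~y)) =
  ⊥-elim (noNonEdge (x , y , Qx , Qy , x≢y , λ x~y → tf x z y x~z z~y x~y))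

module Universal {n} (G : Graph n) where

  Gᵤ : Graph (suc n)
  Gᵤ = addUniversal G

  Iᵤ : IntervalFn (suc n)
  Iᵤ = Ig Gᵤ

  module Geodesic = IntervalFunction (Ig-monotone Gᵤ) (Ig-extensive Gᵤ)
  module P₃ = IntervalFunction (IP3-monotone G) (IP3-extensive G)

  diameter2 : DiameterAtMost2 Gᵤ
  diameter2 zero    zero    = 0 , z≤n , nil zero
  diameter2 zero    (suc _) = 1 , s≤s z≤n , cons refl (nil _)
  diameter2 (suc _) zero    = 1 , s≤s z≤n , cons refl (nil _)
  diameter2 (suc _) (suc _) = 2 , s≤s (s≤s z≤n) , cons {y = u} refl (cons refl (nil _))

  nonEdge-old : ∀ {x y} → NonEdge Gᵤ x y →
                ∃₂ λ x′ y′ → x ≡ suc x′ × y ≡ suc y′ × NonEdge G x′ y′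
  nonEdge-old {zero}  {zero}  (x≢y , _)     = ⊥-elim (x≢y refl)
  nonEdge-old {zero}  {suc _} (_ , ¬x~y)    = ⊥-elim (¬x~y refl)
  nonEdge-old {suc _} {zero}  (_ , ¬x~y)    = ⊥-elim (¬x~y refl)
  nonEdge-old {suc x} {suc y} (x≢y , ¬x~y) = x , y , refl , refl , x≢y ∘ cong suc , ¬x~y

  Ig-old⇒IP3 : ∀ {P} → Iᵤ P ∘ suc ⊆ IP3 G (P ∘ suc)
  Ig-old⇒IP3 (x , y , Px , Py , geo) with onGeodesic-diameter2 Gᵤ diameter2 geo
  ... | inj₁ refl        = inj₁ Px
  ... | inj₂ (inj₁ refl) = inj₁ Py
  ... | inj₂ (inj₂ (xy , x~z , z~y)) with nonEdge-old xy
  ...   | x′ , y′ , refl , refl , (x′≢y′ , _) = inj₂ (x′ , y′ , Px , Py , x′≢y′ , x~z , z~y)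

  Ig-universal⇒ : ∀ {P} → Iᵤ P u → P u ⊎ HasNonEdge G (P ∘ suc)
  Ig-universal⇒ (x , y , Px , Py , geo) with onGeodesic-diameter2 Gᵤ diameter2 geo
  ... | inj₁ refl        = inj₁ Px
  ... | inj₂ (inj₁ refl) = inj₁ Py
  ... | inj₂ (inj₂ (xy , _ , _)) with nonEdge-old xy
  ...   | x′ , y′ , refl , refl , x′y′ = inj₂ (x′ , y′ , Px , Py , x′y′)

  nonEdge⇒Ig-universal : ∀ {P} → HasNonEdge G (P ∘ suc) → Iᵤ P u
  nonEdge⇒Ig-universal (x , y , Px , Py , x≢y , ¬x~y) =
    suc x , suc y , Px , Py , onGeodesic-middle Gᵤ (x≢y ∘ suc-injective , ¬x~y) refl refl

  IP3⇒Ig-old : TriangleFree G → ∀ {P} → IP3 G (P ∘ suc) ⊆ Iᵤ P ∘ suc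
  IP3⇒Ig-old tf (inj₁ Pz) = Ig-extensive Gᵤ Pz
  IP3⇒Ig-old tf {x = z} (inj₂ (x , y , Px , Py , x≢y , x~z , z~y)) =
    suc x , suc y , Px , Py ,
    onGeodesic-middle Gᵤ (x≢y ∘ suc-injective , λ x~y → tf x z y x~z z~y x~y) x~z z~y

  clique-with-universal : ∀ {K} → Clique G K → Clique Gᵤ (true ∷ K)
  clique-with-universal cK zero    zero    _ _ x≢y = ⊥-elim (x≢y refl)
  clique-with-universal cK zero    (suc _) _ _ _   = refl
  clique-with-universal cK (suc _) zero    _ _ _   = refl
  clique-with-universal cK (suc x) (suc y) x∈ y∈ x≢y =
    cK x y (drop-there x∈) (drop-there y∈) (x≢y ∘ cong suc)

  module Restriction (tf : TriangleFree G) (P : VPred (suc n)) {Q : VPred n}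
                     (Q≐P∘suc : Q ≐ P ∘ suc) where

    Q⊆P∘suc : Q ⊆ P ∘ suc
    Q⊆P∘suc = proj₁ Q≐P∘suc

    P∘suc⊆Q : P ∘ suc ⊆ Q
    P∘suc⊆Q = proj₂ Q≐P∘suc

    iter-restrict : ∀ k → iter Iᵤ k P ∘ suc ⊆ iter (IP3 G) k Q
    iter-restrict zero    = P∘suc⊆Q
    iter-restrict (suc k) = IP3-monotone G (iter-restrict k) ∘ Ig-old⇒IP3

    iter-extend : ∀ k → iter (IP3 G) k Q ⊆ iter Iᵤ k P ∘ suc
    iter-extend zero    = Q⊆P∘suc
    iter-extend (suc k) = IP3⇒Ig-old tf ∘ IP3-monotone G (iter-extend k)

    -- A P₃-convex set of G becomes Ig-convex in G_u once u is added to it.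
    withUniversal : VPred n → VPred (suc n)
    withUniversal C zero    = ⊤
    withUniversal C (suc v) = C v

    hull-restrict : Hull Iᵤ P ∘ suc ⊆ Hull (IP3 G) Q
    hull-restrict h C convex Q⊆C = h (withUniversal C) convexᵤ P⊆Cᵤ
      where
      convexᵤ : Convex Iᵤ (withUniversal C)
      convexᵤ zero    _ = tt
      convexᵤ (suc z) x = convex z (Ig-old⇒IP3 x)
      P⊆Cᵤ : ∀ z → P z → withUniversal C z
      P⊆Cᵤ zero    _  = tt
      P⊆Cᵤ (suc z) Pz = Q⊆C z (P∘suc⊆Q Pz)

    hull-extend : Hull (IP3 G) Q ⊆ Hull Iᵤ P ∘ suc
    hull-extend h C convex P⊆C =
      h (C ∘ suc) (λ z → convex (suc z) ∘ IP3⇒Ig-old tf) (λ z → P⊆C (suc z) ∘ Q⊆P∘suc)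

    reachesHull-restrict : ∀ {k} → IterReachesHull Iᵤ P k → IterReachesHull (IP3 G) Q k
    reachesHull-restrict {k} reach v =
      iter-restrict k ∘ proj₁ (reach (suc v)) ∘ hull-extend , P₃.iter⊆hull k

    convex-without-nonEdge : ¬ HasNonEdge G Q → Convex (IP3 G) Q → Convex Iᵤ P
    convex-without-nonEdge noNonEdge convex zero x with Ig-universal⇒ x
    ... | inj₁ Pu        = Pu
    ... | inj₂ nonEdge   = ⊥-elim (noNonEdge (HasNonEdge-mono G P∘suc⊆Q nonEdge))
    convex-without-nonEdge noNonEdge convex (suc z) x =
      Q⊆P∘suc (convex z (IP3-monotone G P∘suc⊆Q (Ig-old⇒IP3 x)))

    universal-hull⇒Ig : Dec (HasNonEdge G Q) → Hull Iᵤ P u → Iᵤ P u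
    universal-hull⇒Ig (yes nonEdge) _ = nonEdge⇒Ig-universal (HasNonEdge-mono G Q⊆P∘suc nonEdge)
    universal-hull⇒Ig (no noNonEdge) h = Ig-extensive Gᵤ (h P convexP λ _ → id)
      where
      convexP : Convex Iᵤ P
      convexP = convex-without-nonEdge noNonEdge (noNonEdge⇒IP3-convex G tf noNonEdge)

    reachesHull-extend : ∀ {k} → Dec (HasNonEdge G Q) → IterReachesHull (IP3 G) Q k → 1 ≤ k →
                         IterReachesHull Iᵤ P k
    reachesHull-extend {k} nonEdge? reach 1≤k zero =
      Geodesic.iter-increasing 1≤k ∘ universal-hull⇒Ig nonEdge? , Geodesic.iter⊆hull k
    reachesHull-extend {k} nonEdge? reach 1≤k (suc v) =
      iter-extend k ∘ proj₁ (reach v) ∘ hull-restrict , Geodesic.iter⊆hull k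

  module _ (tf : TriangleFree G) where

    iterTime-extend : ∀ {S t} → HasNonEdge G ⟦ S ⟧ → IsIterTimeOf (IP3 G) S t →
                      IsIterTimeOf Iᵤ (false ∷ S) (t ⊔ 1)
    iterTime-extend {S} {t} nonEdge (reach , minimal) = reachᵤ , minimalᵤ
      where
      open Restriction tf ⟦ false ∷ S ⟧ (restrict-cons false S)
      reachᵤ : IterReachesHull Iᵤ ⟦ false ∷ S ⟧ (t ⊔ 1)
      reachᵤ = reachesHull-extend (yes nonEdge) (P₃.reachesHull-mono reach (m≤m⊔n t 1)) (m≤n⊔m t 1)
      universal∈I : Iᵤ ⟦ false ∷ S ⟧ u
      universal∈I = nonEdge⇒Ig-universal (HasNonEdge-mono G Q⊆P∘suc nonEdge)
      minimalᵤ : ∀ j → j < t ⊔ 1 → ¬ IterReachesHull Iᵤ ⟦ false ∷ S ⟧ j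
      minimalᵤ zero _ reach0 with proj₁ (reach0 u) (Geodesic.iter⊆hull 1 universal∈I)
      ... | ()
      minimalᵤ (suc j) j<t⊔1 = minimal (suc j) (s<n⊔1⇒s<n {t = t} j<t⊔1) ∘ reachesHull-restrict {suc j}

    iterTime-bound : ∀ {t} → (∀ S j → IsIterTimeOf (IP3 G) S j → j ≤ t) →
                     ∀ S j → IsIterTimeOf Iᵤ S j → j ≤ t ⊔ 1
    iterTime-bound {t} bound (b ∷ S) j (reach , minimal) with j ≤? t ⊔ 1
    ... | yes j≤ = j≤
    ... | no  j≰ = ⊥-elim (¬¬-least (IterReachesHull (IP3 G) ⟦ S ⟧) {j} (reachesHull-restrict {j} reach) reachedEarlier)
      where
      open Restriction tf ⟦ b ∷ S ⟧ (restrict-cons b S)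
      reachedEarlier : ¬ Least (IterReachesHull (IP3 G) ⟦ S ⟧)
      reachedEarlier (i , time) =
        minimal (t ⊔ 1) (≰⇒> j≰)
          (reachesHull-extend (hasNonEdge? G S)
            (P₃.reachesHull-mono (proj₁ time) (≤-trans (bound S i time) (m≤m⊔n t 1)))
            (m≤n⊔m t 1))

    iterTime : 3 ≤ n → ∀ t → IsIterTime (IP3 G) t → IsIterTime Iᵤ (t ⊔ 1)
    iterTime n≥3 t ((S , time) , bound) = witness t time , iterTime-bound bound
      where
      -- V(G) is P₃-convex, so its iteration time is 0; it has a non-edge since n ≥ 3.
      witness : ∀ t → IsIterTimeOf (IP3 G) S t → ∃ λ Sᵤ → IsIterTimeOf Iᵤ Sᵤ (t ⊔ 1)
      witness zero _ with triangleFree⇒nonEdge G tf n≥3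
      ... | x , y , xy =
        false ∷ full , iterTime-extend {t = 0} (x , y , ∈⊤ , ∈⊤ , xy)
                                       (P₃.convex⇒reachesHull0 {⟦ full ⟧} (λ _ _ → ∈⊤) , λ _ ())
      witness (suc t) time with hasNonEdge? G S
      ... | yes nonEdge   = false ∷ S , iterTime-extend nonEdge time
      ... | no  noNonEdge =
        ⊥-elim (proj₂ time 0 (s≤s z≤n) (P₃.convex⇒reachesHull0 (noNonEdge⇒IP3-convex G tf noNonEdge)))

    gp-without-universal⇒ : ∀ S → GeneralPosition Iᵤ (false ∷ S) → GeneralPosition (IP3 G) S
    gp-without-universal⇒ S gp x y z x∈ y∈ z∈ x≢y x≢z y≢z (inj₁ z∈xy) =
      Sum.[ x≢z ∘ sym , y≢z ∘ sym ] z∈xy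
    gp-without-universal⇒ S gp x y z x∈ y∈ z∈ x≢y x≢z y≢z (inj₂ middle) =
      gp (suc x) (suc y) (suc z) (there x∈) (there y∈) (there z∈)
         (x≢y ∘ suc-injective) (x≢z ∘ suc-injective) (y≢z ∘ suc-injective)
         (IP3⇒Ig-old tf (IP3-monotone G (pair-map suc) (inj₂ middle)))

    gp-without-universal⇐ : ∀ S → GeneralPosition (IP3 G) S → GeneralPosition Iᵤ (false ∷ S)
    gp-without-universal⇐ S gp (suc x) (suc y) (suc z) x∈ y∈ z∈ x≢y x≢z y≢z =
      gp x y z (drop-there x∈) (drop-there y∈) (drop-there z∈)
         (x≢y ∘ cong suc) (x≢z ∘ cong suc) (y≢z ∘ cong suc)
      ∘ IP3-monotone G pair-suc⁻¹ ∘ Ig-old⇒IP3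

    gp-with-universal⇒ : ∀ S → GeneralPosition Iᵤ (true ∷ S) → Clique G S
    gp-with-universal⇒ S gp x y x∈ y∈ x≢y with adj G x y Bool.≟ true
    ... | yes x~y = x~y
    ... | no ¬x~y = ⊥-elim (gp (suc x) (suc y) u (there x∈) (there y∈) here
                              (x≢y ∘ suc-injective) (λ ()) (λ ())
                              (nonEdge⇒Ig-universal (x , y , inj₁ refl , inj₂ refl , x≢y , ¬x~y)))

    gp-with-universal⇐ : ∀ K → Clique G K → GeneralPosition Iᵤ (true ∷ K)
    gp-with-universal⇐ K cK x y z x∈ y∈ z∈ x≢y x≢z y≢z =
      Sum.[ x≢z ∘ sym , y≢z ∘ sym ] ∘ Ig-closed-pairwiseAdjacent Gᵤ diameter2 adjacent
      where
      ∈K : ∀ {w} → pair x y w → w ∈ (true ∷ K)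
      ∈K (inj₁ refl) = x∈
      ∈K (inj₂ refl) = y∈
      adjacent : ∀ {a b} → pair x y a → pair x y b → a ≢ b → Adj Gᵤ a b
      adjacent a∈ b∈ = clique-with-universal cK _ _ (∈K a∈) (∈K b∈)

    gpNumber : ∀ p w → IsGpNumber (IP3 G) p → IsCliqueNumber G w → IsGpNumber Iᵤ (p ⊔ suc w)
    gpNumber p w ((S , gpS , ∣S∣) , boundS) ((K , cK , ∣K∣) , boundK) = witness , bound
      where
      witness : ∃ λ Sᵤ → GeneralPosition Iᵤ Sᵤ × ∣ Sᵤ ∣ ≡ p ⊔ suc w
      witness with suc w ≤? p
      ... | yes w<p = false ∷ S , gp-without-universal⇐ S gpS , trans ∣S∣ (sym (m≥n⇒m⊔n≡m w<p))
      ... | no  w≮p = true ∷ K , gp-with-universal⇐ K cK ,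
                      trans (cong suc ∣K∣) (sym (m≤n⇒m⊔n≡n (<⇒≤ (≰⇒> w≮p))))
      bound : ∀ Sᵤ → GeneralPosition Iᵤ Sᵤ → ∣ Sᵤ ∣ ≤ p ⊔ suc w
      bound (false ∷ S′) gp =
        ≤-trans (boundS S′ (gp-without-universal⇒ S′ gp)) (m≤m⊔n p (suc w))
      bound (true ∷ S′) gp =
        ≤-trans (s≤s (boundK S′ (gp-with-universal⇒ S′ gp))) (m≤n⊔m p (suc w))

lemma5 : ∀ {n} (G : Graph n) → TriangleFree G → 3 ≤ n →
    (∀ t → IsIterTime (IP3 G) t → IsIterTime (Ig (addUniversal G)) (t ⊔ 1))
    × (∀ p w → IsGpNumber (IP3 G) p → IsCliqueNumber G w →
         IsGpNumber (Ig (addUniversal G)) (p ⊔ suc w))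
lemma5 G tf n≥3 = Universal.iterTime G tf n≥3 , Universal.gpNumber G tf
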